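{- (Constructively.) For a countable signature, let $\mathcal M$ be a model admitting a blurred Henkin environment $\rho:\mathbb N\to\mathcal M$. Then there is a model $\mathcal N$ whose domain is the (countable) type $\mathbb T$ of terms, together with an elementary embedding $\mathcal N\to\mathcal M$.
   Context: First-order logic without equality over a signature with countably many function and relation symbols; variables are de Bruijn indices $\mathsf x_n$, terms $\mathbb T$, formulas built from $\dot\bot$, atoms, $\dot\to,\dot\land,\dot\lor,\dot\forall,\dot\exists$ (a quantifier binds index $0$). A model is a type with interpretations of symbols; $\mathcal M\vDash_\rho\phi$ is Tarski satisfaction for $\rho:\mathbb N\to\mathcal M$, and $\mathcal M\vDash_\rho\phi[a]$ means satisfaction in the environment $\mathsf x_0\mapsto a$, $\mathsf x_{k+1}\mapsto\rho\,k$. An environment $\rho$ is a blurred Henkin environment if for every formula $\phi$: $(\forall n.\,\mathcal M\vDash_\rho\phi[\rho\,n])\to\mathcal M\vDash_\rho\dot\forall\phi$, and $\mathcal M\vDash_\rho\dot\exists\phi\to\exists n.\,\mathcal M\vDash_\rho\phi[\rho\,n]$. A map $h:\mathcal N\to\mathcal M$ is an elementary embedding if for all $\sigma:\mathbb N\to\mathcal N$ and formulas $\phi$, $\mathcal N\vDash_\sigma\phi\leftrightarrow\mathcal M\vDash_{h\circ\sigma}\phi$. -}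

module Defs where

open import Data.Nat using (ℕ; zero; suc)
open import Data.Vec using (Vec; []; _∷_)
open import Data.Product using (Σ; _×_; ∃; _,_)
open import Data.Sum using (_⊎_)
open import Data.Empty using (⊥)
open import Function using (_∘_)
open import Function.Definitions using (Injective)
open import Relation.Binary.PropositionalEquality using (_≡_)

record Signature : Set₁ where
  field
    Funs  : Set
    fun-ar : Funs → ℕ
    Preds : Set
    pred-ar : Preds → ℕ
open Signature public

Countable : Set → Set
Countable A = Σ (A → ℕ) λ e → Injective _≡_ _≡_ e

CountableSig : Signature → Set
CountableSig Σ' = Countable (Funs Σ') × Countable (Preds Σ')

module Syntax (S : Signature) where

  data Term : Set where
    var  : ℕ → Term
    func : (f : Funs S) → Vec Term (fun-ar S f) → Term

  data BinOp : Set where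
    imp conj disj : BinOp

  data Quant : Set where
    all ex : Quant

  -- formulas; a quantifier binds index 0
  data Form : Set where
    fal  : Form
    atom : (P : Preds S) → Vec Term (pred-ar S P) → Form
    bin  : BinOp → Form → Form → Form
    quant : Quant → Form → Form

  _⇒̇_ _∧̇_ _∨̇_ : Form → Form → Form
  φ ⇒̇ ψ = bin imp φ ψ
  φ ∧̇ ψ = bin conj φ ψ
  φ ∨̇ ψ = bin disj φ ψ

  ∀̇ ∃̇ : Form → Form
  ∀̇ φ = quant all φ
  ∃̇ φ = quant ex φ

  record Interp (D : Set) : Set₁ where
    field
      i-fun  : (f : Funs S) → Vec D (fun-ar S f) → D
      i-pred : (P : Preds S) → Vec D (pred-ar S P) → Set
  open Interp public

  _∷ₑ_ : {D : Set} → D → (ℕ → D) → ℕ → D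
  (a ∷ₑ ρ) zero = a
  (a ∷ₑ ρ) (suc k) = ρ k

  module Semantics {D : Set} (I : Interp D) where
    mutual
      eval : (ℕ → D) → Term → D
      eval ρ (var n) = ρ n
      eval ρ (func f v) = i-fun I f (evalVec ρ v)

      evalVec : ∀ {n} → (ℕ → D) → Vec Term n → Vec D n
      evalVec ρ [] = []
      evalVec ρ (t ∷ v) = eval ρ t ∷ evalVec ρ v

    sat : (ℕ → D) → Form → Set
    sat ρ fal = ⊥
    sat ρ (atom P v) = i-pred I P (evalVec ρ v)
    sat ρ (bin imp φ ψ) = sat ρ φ → sat ρ ψ
    sat ρ (bin conj φ ψ) = sat ρ φ × sat ρ ψ
    sat ρ (bin disj φ ψ) = sat ρ φ ⊎ sat ρ ψ
    sat ρ (quant all φ) = (a : D) → sat (a ∷ₑ ρ) φ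
    sat ρ (quant ex φ) = Σ D λ a → sat (a ∷ₑ ρ) φ

  _⊨[_]_ : {D : Set} → Interp D → (ℕ → D) → Form → Set
  I ⊨[ ρ ] φ = Semantics.sat I ρ φ

  BlurredHenkin : {D : Set} → Interp D → (ℕ → D) → Set
  BlurredHenkin I ρ =
    ((φ : Form) → ((n : ℕ) → I ⊨[ ρ n ∷ₑ ρ ] φ) → I ⊨[ ρ ] ∀̇ φ) ×
    ((φ : Form) → I ⊨[ ρ ] ∃̇ φ → ∃ λ n → I ⊨[ ρ n ∷ₑ ρ ] φ)

  ElementaryEmbedding : {N M : Set} → Interp N → Interp M → (N → M) → Set
  ElementaryEmbedding IN IM h =
    (σ : ℕ → _) (φ : Form) →
      (IN ⊨[ σ ] φ → IM ⊨[ h ∘ σ ] φ) × (IM ⊨[ h ∘ σ ] φ → IN ⊨[ σ ] φ)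

-- The terms form a model N of their own: function symbols act freely, and an
-- atom holds in N iff it holds in M after evaluating its terms under ρ.  The map
-- h = eval ρ is then elementary by induction on formulas.  Only the quantifier
-- steps need the Henkin property: substituting the current assignment σ into
-- φ gives a formula whose instances at the witnesses ρ n are exactly the
-- instances of φ at the variable terms var n, so "for all terms" in N becomes
-- "for all ρ n" in M, which the blurred Henkin property upgrades to "for all
-- elements of M" (dually for ∃).
module Submission where

open import Defs
open import Data.Nat using (ℕ; zero; suc)
open import Data.Product using (Σ; _,_; proj₁; proj₂)
open import Data.Sum using (inj₁; inj₂)
open import Data.Vec using (Vec; []; _∷_)
open import Function using (_∘_)
open import Function.Bundles using (_⇔_; mk⇔; Equivalence)
import Function.Properties.Equivalence as ⇔
open import Relation.Binary.PropositionalEquality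
  using (_≡_; refl; trans; cong; cong₂; module ≡-Reasoning)

open Equivalence using (to; from)

cong-⇔ : {A : Set} (F : A → Set) {x y : A} → x ≡ y → F x ⇔ F y
cong-⇔ F refl = ⇔.refl

module Environment (S : Signature) where
  open Syntax S

  map-∷ₑ : {A B : Set} (f : A → B) {a : A} {σ : ℕ → A} {τ : ℕ → B} →
    (∀ n → f (σ n) ≡ τ n) → ∀ n → f ((a ∷ₑ σ) n) ≡ (f a ∷ₑ τ) n
  map-∷ₑ f eq zero    = refl
  map-∷ₑ f eq (suc n) = eq n

module TermSubstitution (S : Signature) where
  open Syntax S

  mutual
    sub : (ℕ → Term) → Term → Term
    sub σ (var n)    = σ n
    sub σ (func f v) = func f (subVec σ v)

    subVec : ∀ {k} → (ℕ → Term) → Vec Term k → Vec Term k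
    subVec σ []      = []
    subVec σ (t ∷ v) = sub σ t ∷ subVec σ v

  ⇑ : (ℕ → Term) → ℕ → Term
  ⇑ σ = var zero ∷ₑ (sub (var ∘ suc) ∘ σ)

  subForm : (ℕ → Term) → Form → Form
  subForm σ fal         = fal
  subForm σ (atom P v)  = atom P (subVec σ v)
  subForm σ (bin o φ ψ) = bin o (subForm σ φ) (subForm σ ψ)
  subForm σ (quant q φ) = quant q (subForm (⇑ σ) φ)

module Congruence (S : Signature) where
  open Syntax S

  bin-⇔ : ∀ {D D'} {I : Interp D} {I' : Interp D'} {τ τ'} o {φ ψ φ' ψ'} →
    I ⊨[ τ ] φ ⇔ I' ⊨[ τ' ] φ' → I ⊨[ τ ] ψ ⇔ I' ⊨[ τ' ] ψ' →
    I ⊨[ τ ] bin o φ ψ ⇔ I' ⊨[ τ' ] bin o φ' ψ'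
  bin-⇔ imp  φ⇔ ψ⇔ = mk⇔ (λ f → to ψ⇔ ∘ f ∘ from φ⇔) (λ f → from ψ⇔ ∘ f ∘ to φ⇔)
  bin-⇔ conj φ⇔ ψ⇔ = mk⇔ (λ (x , y) → to φ⇔ x , to ψ⇔ y) (λ (x , y) → from φ⇔ x , from ψ⇔ y)
  bin-⇔ disj φ⇔ ψ⇔ = mk⇔
    (λ { (inj₁ x) → inj₁ (to φ⇔ x)   ; (inj₂ y) → inj₂ (to ψ⇔ y) })
    (λ { (inj₁ x) → inj₁ (from φ⇔ x) ; (inj₂ y) → inj₂ (from ψ⇔ y) })

  quant-⇔ : ∀ {D} {I I' : Interp D} {τ τ'} q {φ φ'} →
    (∀ a → I ⊨[ a ∷ₑ τ ] φ ⇔ I' ⊨[ a ∷ₑ τ' ] φ') →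
    I ⊨[ τ ] quant q φ ⇔ I' ⊨[ τ' ] quant q φ'
  quant-⇔ all φ⇔ = mk⇔ (λ f a → to (φ⇔ a) (f a)) (λ f a → from (φ⇔ a) (f a))
  quant-⇔ ex  φ⇔ = mk⇔ (λ (a , x) → a , to (φ⇔ a) x) (λ (a , x) → a , from (φ⇔ a) x)

module SubstitutionLemma (S : Signature) {D : Set} (I : Syntax.Interp S D) where
  open Syntax S
  open Semantics I
  open Environment S
  open TermSubstitution S
  open Congruence S

  mutual
    eval-sub : ∀ {τ τ'} σ → (∀ n → eval τ (σ n) ≡ τ' n) →
      ∀ t → eval τ (sub σ t) ≡ eval τ' t
    eval-sub σ eq (var n)    = eq n
    eval-sub σ eq (func f v) = cong (i-fun I f) (evalVec-sub σ eq v)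

    evalVec-sub : ∀ {τ τ' k} σ → (∀ n → eval τ (σ n) ≡ τ' n) →
      (v : Vec Term k) → evalVec τ (subVec σ v) ≡ evalVec τ' v
    evalVec-sub σ eq []      = refl
    evalVec-sub σ eq (t ∷ v) = cong₂ _∷_ (eval-sub σ eq t) (evalVec-sub σ eq v)

  eval-⇑ : ∀ {τ τ'} σ → (∀ n → eval τ (σ n) ≡ τ' n) →
    ∀ a n → eval (a ∷ₑ τ) (⇑ σ n) ≡ (a ∷ₑ τ') n
  eval-⇑ {τ} σ eq a = map-∷ₑ (eval (a ∷ₑ τ)) λ n →
    trans (eval-sub (var ∘ suc) (λ _ → refl) (σ n)) (eq n)

  sat-subForm : ∀ {τ τ'} σ → (∀ n → eval τ (σ n) ≡ τ' n) →
    ∀ φ → sat τ (subForm σ φ) ⇔ sat τ' φ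
  sat-subForm σ eq fal         = ⇔.refl
  sat-subForm σ eq (atom P v)  = cong-⇔ (i-pred I P) (evalVec-sub σ eq v)
  sat-subForm σ eq (bin o φ ψ) = bin-⇔ o (sat-subForm σ eq φ) (sat-subForm σ eq ψ)
  sat-subForm σ eq (quant q φ) = quant-⇔ q λ a → sat-subForm (⇑ σ) (eval-⇑ σ eq a) φ

module TermModel (S : Signature) {D : Set} (M : Syntax.Interp S D) (ρ : ℕ → D)
                 (henkin : Syntax.BlurredHenkin S M ρ) where
  open Syntax S
  open Semantics M
  open Environment S
  open TermSubstitution S
  open Congruence S
  open SubstitutionLemma S M

  N : Interp Term
  N = record { i-fun = func ; i-pred = λ P v → i-pred M P (evalVec ρ v) }

  h : Term → D
  h = eval ρ

  module N = Semantics N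

  mutual
    evalN≡sub : ∀ σ t → N.eval σ t ≡ sub σ t
    evalN≡sub σ (var n)    = refl
    evalN≡sub σ (func f v) = cong (func f) (evalVecN≡subVec σ v)

    evalVecN≡subVec : ∀ {k} σ (v : Vec Term k) → N.evalVec σ v ≡ subVec σ v
    evalVecN≡subVec σ []      = refl
    evalVecN≡subVec σ (t ∷ v) = cong₂ _∷_ (evalN≡sub σ t) (evalVecN≡subVec σ v)

  -- Stated for any τ pointwise equal to h ∘ σ, since h ∘ (t ∷ₑ σ) and
  -- h t ∷ₑ (h ∘ σ) agree only pointwise.
  truth : ∀ {σ τ} → (∀ n → h (σ n) ≡ τ n) → ∀ φ → N ⊨[ σ ] φ ⇔ M ⊨[ τ ] φ
  truth eq fal         = ⇔.refl
  truth {σ} {τ} eq (atom P v) = cong-⇔ (i-pred M P) (begin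
    evalVec ρ (N.evalVec σ v)  ≡⟨ cong (evalVec ρ) (evalVecN≡subVec σ v) ⟩
    evalVec ρ (subVec σ v)     ≡⟨ evalVec-sub σ eq v ⟩
    evalVec τ v                ∎)
    where open ≡-Reasoning
  truth eq (bin o φ ψ) = bin-⇔ o (truth eq φ) (truth eq ψ)
  truth {σ} {τ} eq (quant q φ) = quant-case q
    where
    at-term : ∀ t → N ⊨[ t ∷ₑ σ ] φ ⇔ M ⊨[ h t ∷ₑ τ ] φ
    at-term t = truth (map-∷ₑ h eq) φ

    φσ : Form
    φσ = subForm (⇑ σ) φ

    at-element : ∀ a → M ⊨[ a ∷ₑ ρ ] φσ ⇔ M ⊨[ a ∷ₑ τ ] φ
    at-element a = sat-subForm (⇑ σ) (eval-⇑ σ eq a) φ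

    at-witness : ∀ n → N ⊨[ var n ∷ₑ σ ] φ ⇔ M ⊨[ ρ n ∷ₑ ρ ] φσ
    at-witness n = ⇔.trans (at-term (var n)) (⇔.sym (at-element (ρ n)))

    quant-case : ∀ q → N ⊨[ σ ] quant q φ ⇔ M ⊨[ τ ] quant q φ
    quant-case all = mk⇔
      (λ f a → to (at-element a) (proj₁ henkin φσ (λ n → to (at-witness n) (f (var n))) a))
      (λ f t → from (at-term t) (f (h t)))
    quant-case ex = mk⇔
      (λ (t , x) → h t , to (at-term t) x)
      (λ (a , x) → let (n , y) = proj₂ henkin φσ (a , from (at-element a) x)
                   in var n , from (at-witness n) y)

-- Countability of the signature only makes Term countable; the construction
-- itself does not use it.
theorem6p2 : (S : Signature) → CountableSig S →
    let open Syntax S in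
    (D : Set) (M : Interp D) (ρ : ℕ → D) → BlurredHenkin M ρ →
    Σ (Interp Term) λ N → Σ (Term → D) λ h → ElementaryEmbedding N M h
theorem6p2 S _ D M ρ henkin =
  N , h , λ σ φ → let φ⇔ = truth (λ _ → refl) φ in to φ⇔ , from φ⇔
  where open TermModel S M ρ henkin
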